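{- The set $\mathrm{Sort}(\mathfrak{s}_{1\underline{23}})=\bigcup_{n\ge1}\mathrm{Sort}_n(\mathfrak{s}_{1\underline{23}})$ is a permutation class, i.e. if $\pi\in\mathrm{Sort}(\mathfrak{s}_{1\underline{23}})$ and $\rho$ is a permutation contained (classically) in $\pi$, then $\rho\in\mathrm{Sort}(\mathfrak{s}_{1\underline{23}})$.
   Context: A pattern is a permutation $\sigma$ in which some blocks of consecutive entries may be underlined; a sequence contains it if it has a subsequence order-isomorphic to $\sigma$ whose entries corresponding to a common underlined block are adjacent in the sequence. Pattern-avoiding stack map $\mathfrak{s}_\sigma$: process input $\tau_1,\dots,\tau_n$ in order; when $\tau_i$ is next, while the stack is nonempty and the sequence formed by placing $\tau_i$ on top of the stack, read top to bottom, contains $\sigma$ (underlined entries adjacent in the stack), pop the top entry to the output; then push $\tau_i$; at the end pop all remaining entries top to bottom to the output. West's stack-sorting map $s$ pushes each input entry after popping all smaller stack entries to the output, emptying the stack at the end. $\mathrm{Sort}_n(\mathfrak{s}_\sigma)=\{\tau\in\mathfrak S_n: s(\mathfrak{s}_\sigma(\tau))=12\cdots n\}$ (equivalently $\mathfrak{s}_\sigma(\tau)$ avoids $231$). -}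

module Defs where

open import Data.Nat using (ℕ; zero; suc; _<_; _≤_; _<ᵇ_)
open import Data.Bool using (Bool; true; false; _∧_; _∨_; if_then_else_)
open import Data.List using (List; []; _∷_; _++_; map; upTo; length; lookup)
open import Data.Product using (Σ; _×_; _,_)
open import Data.Fin using (Fin; cast)
open import Function.Bundles using (_⇔_)
open import Relation.Binary.PropositionalEquality using (_≡_)
open import Data.List.Relation.Binary.Permutation.Propositional using (_↭_)
open import Data.List.Relation.Binary.Sublist.Propositional using (_⊆_)

-- Permutations of [n] = {1,…,n} in one-line notation, as lists.
idPerm : ℕ → List ℕ
idPerm n = map suc (upTo n)

IsPerm : ℕ → List ℕ → Set
IsPerm n xs = xs ↭ idPerm n

OrderIso : List ℕ → List ℕ → Set
OrderIso xs ys = Σ (length xs ≡ length ys) λ eq →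
  ∀ (i j : Fin (length xs)) →
    (lookup xs i < lookup xs j) ⇔ (lookup ys (cast eq i) < lookup ys (cast eq j))

Contains : List ℕ → List ℕ → Set
Contains π ρ = Σ (List ℕ) λ sub → (sub ⊆ π) × OrderIso sub ρ

-- Containment of the pattern 1\underline{23} in a sequence x₁ x₂ …:
-- indices a < b with x_a < x_b < x_{b+1} (entries b, b+1 adjacent).
-- adjAbove x ys : some adjacent pair (y , z) in ys with x < y < z.
adjAbove : ℕ → List ℕ → Bool
adjAbove x (y ∷ z ∷ r) = ((x <ᵇ y) ∧ (y <ᵇ z)) ∨ adjAbove x (z ∷ r)
adjAbove x _ = false

contains1-23 : List ℕ → Bool
contains1-23 [] = false
contains1-23 (x ∷ xs) = adjAbove x xs ∨ contains1-23 xs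

-- Stacks are lists with the top entry at the head.
-- One step of 𝔰_{1\underline{23}} with next input t: returns (popped output, new stack).
popStep : ℕ → List ℕ → List ℕ × List ℕ
popStep t [] = [] , t ∷ []
popStep t (h ∷ st) with contains1-23 (t ∷ h ∷ st)
... | true  with popStep t st
...   | o , st' = h ∷ o , st'
popStep t (h ∷ st) | false = [] , t ∷ h ∷ st

runS123 : List ℕ → List ℕ → List ℕ
runS123 stack [] = stack
runS123 stack (x ∷ xs) with popStep x stack
... | o , st' = o ++ runS123 st' xs

s123 : List ℕ → List ℕ
s123 τ = runS123 [] τ

westStep : ℕ → List ℕ → List ℕ × List ℕ
westStep t [] = [] , t ∷ []
westStep t (h ∷ st) with h <ᵇ t
... | true with westStep t st
...   | o , st' = h ∷ o , st'
westStep t (h ∷ st) | false = [] , t ∷ h ∷ st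

runWest : List ℕ → List ℕ → List ℕ
runWest stack [] = stack
runWest stack (x ∷ xs) with westStep x stack
... | o , st' = o ++ runWest st' xs

west : List ℕ → List ℕ
west τ = runWest [] τ

InSortN : ℕ → List ℕ → Set
InSortN n τ = IsPerm n τ × (west (s123 τ) ≡ idPerm n)

InSort : List ℕ → Set
InSort τ = Σ ℕ λ n → (1 ≤ n) × InSortN n τ

module Submission where

-- Write π = γ m δ with m the least entry of π, and 𝔰 = 𝔰_{1\underline{23}}. When m arrives it is
-- smaller than everything on the stack, so it pops exactly while the stack has an adjacent ascent;
-- afterwards nothing can pop it or what lies below it, and δ is processed as on an empty stack.
-- Hence 𝔰(m δ) = 𝔰(δ) m and, for γ ≠ ε, 𝔰(γ m δ) = F 𝔰(δ) m B, where 𝔰(γ) = F B and B is the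
-- ascent-free bottom of the final stack of γ. Induction along this decomposition shows that 𝔰(π)
-- avoids 231 iff π avoids 132, 3214 and 4213, and the analogous decomposition of West's map at the
-- maximum shows that s(σ) is sorted iff σ avoids 231. So Sort(𝔰) = Av(132, 3214, 4213), and a
-- class defined by avoidance is closed under containment.

open import Defs
open import Data.Bool using (Bool; true; false; T; _∧_; _∨_; if_then_else_)
open import Data.Bool.Properties using (T-≡; ∨-zeroʳ; ∧-zeroʳ; ∨-conicalˡ; ∨-conicalʳ)
open import Data.Empty using (⊥; ⊥-elim)
open import Data.Fin using (cast) renaming (zero to fzero; suc to fsuc)
open import Data.List using (List; []; _∷_; _++_; [_]; length; map; zip; lookup)
open import Data.List.Extrema.Nat using (min; max; min≤⊤; min≤xs; ⊥≤max; xs≤max; argmin-sel; argmax-sel)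
open import Data.List.Properties using (++-assoc; ++-identityʳ; length-++)
open import Data.List.Membership.Propositional using (_∈_; _∉_)
open import Data.List.Membership.Propositional.Properties using (∈-++⁻; ∈-++⁺ˡ; ∈-++⁺ʳ; ∈-∃++)
open import Data.List.Relation.Unary.All as All using (All; []; _∷_)
import Data.List.Relation.Unary.All.Properties as All
open import Data.List.Relation.Unary.AllPairs as AllPairs using (AllPairs; []; _∷_)
import Data.List.Relation.Unary.AllPairs.Properties as AllPairs
open import Data.List.Relation.Unary.Any using (here; there)
open import Data.List.Relation.Unary.Linked.Properties using (AllPairs⇒Linked)
open import Data.List.Relation.Unary.Sorted.TotalOrder using (Sorted)
open import Data.List.Relation.Unary.Sorted.TotalOrder.Properties using (↗↭↗⇒≋)
open import Data.List.Relation.Unary.Unique.Propositional using (Unique)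
import Data.List.Relation.Unary.Unique.Propositional.Properties as Unique
open import Data.List.Relation.Binary.Equality.Propositional using (≋⇒≡)
open import Data.List.Relation.Binary.Sublist.Propositional
  using (_⊆_; []; _∷_; _∷ʳ_; ⊆-refl; ⊆-trans; from∈; to∈; minimum)
import Data.List.Relation.Binary.Sublist.Propositional.Properties as Sublist
open import Data.List.Relation.Binary.Permutation.Propositional
  using (_↭_; ↭-sym; ↭-trans; ↭-reflexive; ↭⇒↭ₛ; module PermutationReasoning)
open import Data.List.Relation.Binary.Permutation.Propositional.Properties
  using (∈-resp-↭; All-resp-↭; ++⁺ˡ; shift)
import Data.List.Relation.Binary.Permutation.Setoid.Properties as Permutationₛ
open import Data.Nat using (ℕ; suc; pred; z<s; s≤s; _≤_; _<_; _≥_; _>_; _<ᵇ_)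
open import Data.Nat.Induction using (<-wellFounded)
open import Data.Nat.Properties
  using ( ≤-refl; ≤-trans; <-trans; ≤-<-trans; <-irrefl; <-asym; <-cmp; <⇒≤; ≤⇒≯; ≮⇒≥; ≤∧≢⇒<
        ; m<m+n; m≤n+m; <⇒<ᵇ; <ᵇ⇒<; suc-injective; ≤-totalOrder)
open import Data.Product using (∃; ∃₂; _×_; _,_; proj₁; proj₂)
open import Data.Sum using (_⊎_; inj₁; inj₂; [_,_]′)
open import Function using (Equivalence; id; _∘_)
open import Induction.WellFounded using (Acc; acc)
import Relation.Binary.Construct.On as On
open import Relation.Binary.Definitions using (tri<; tri≈; tri>)
open import Relation.Binary.PropositionalEquality
  using (_≡_; _≢_; refl; sym; trans; cong; cong₂; subst; setoid; module ≡-Reasoning)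
open import Relation.Nullary using (contradiction)

-- Sublists and lists of distinct entries

private variable
  A B : Set
  R : A → A → Set

⊆-++⁻ : ∀ {ws : List A} xs ys → ws ⊆ xs ++ ys →
  ∃₂ λ ws₁ ws₂ → ws ≡ ws₁ ++ ws₂ × ws₁ ⊆ xs × ws₂ ⊆ ys
⊆-++⁻ [] ys p = [] , _ , refl , [] , p
⊆-++⁻ (x ∷ xs) ys (.x ∷ʳ p) with ⊆-++⁻ xs ys p
... | ws₁ , ws₂ , refl , p₁ , p₂ = ws₁ , ws₂ , refl , x ∷ʳ p₁ , p₂
⊆-++⁻ (x ∷ xs) ys (refl ∷ p) with ⊆-++⁻ xs ys p
... | ws₁ , ws₂ , refl , p₁ , p₂ = x ∷ ws₁ , ws₂ , refl , refl ∷ p₁ , p₂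

xs⊆xs++ys : ∀ (xs {ys} : List A) → xs ⊆ xs ++ ys
xs⊆xs++ys xs {ys} = Sublist.++⁺ʳ ys ⊆-refl

ys⊆xs++ys : ∀ (xs {ys} : List A) → ys ⊆ xs ++ ys
ys⊆xs++ys xs = Sublist.++⁺ˡ xs ⊆-refl

⊆-prefix : ∀ (xs {ys zs} : List A) → xs ++ ys ⊆ zs → xs ⊆ zs
⊆-prefix xs = ⊆-trans (xs⊆xs++ys xs)

⊆-map⁻ : ∀ (f : A → B) {ws} zs → ws ⊆ map f zs → ∃ λ us → us ⊆ zs × map f us ≡ ws
⊆-map⁻ f [] [] = [] , [] , refl
⊆-map⁻ f (z ∷ zs) (_ ∷ʳ p) = let us , q , eq = ⊆-map⁻ f zs p in us , z ∷ʳ q , eq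
⊆-map⁻ f (z ∷ zs) (refl ∷ p) = let us , q , eq = ⊆-map⁻ f zs p in z ∷ us , refl ∷ q , cong (f z ∷_) eq

AllPairs-resp-⊇ : ∀ {xs ys : List A} → ys ⊆ xs → AllPairs R xs → AllPairs R ys
AllPairs-resp-⊇ [] rs = rs
AllPairs-resp-⊇ (y ∷ʳ p) (_ ∷ rs) = AllPairs-resp-⊇ p rs
AllPairs-resp-⊇ (refl ∷ p) (r ∷ rs) = Sublist.All-resp-⊆ p r ∷ AllPairs-resp-⊇ p rs

Unique-++⇒disjoint : ∀ (xs : List A) {ys x} → Unique (xs ++ ys) → x ∈ xs → x ∉ ys
Unique-++⇒disjoint (_ ∷ xs) (x∉ ∷ _) (here refl) x∈ys = All.lookup x∉ (∈-++⁺ʳ xs x∈ys) refl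
Unique-++⇒disjoint (_ ∷ xs) (_ ∷ u) (there x∈) = Unique-++⇒disjoint xs u x∈

Unique⇒≢ : ∀ {x y : A} {ys} → Unique ys → x ∷ y ∷ [] ⊆ ys → x ≢ y
Unique⇒≢ u p with AllPairs-resp-⊇ p u
... | x≢y ∷ _ = All.head x≢y

∈-∈⇒pair⊆ : ∀ {x y : A} {ys} → x ∈ ys → y ∈ ys → x ≢ y → x ∷ y ∷ [] ⊆ ys ⊎ y ∷ x ∷ [] ⊆ ys
∈-∈⇒pair⊆ (here refl) (here refl) x≢y with () ← x≢y refl
∈-∈⇒pair⊆ (here refl) (there y∈) _ = inj₁ (refl ∷ from∈ y∈)
∈-∈⇒pair⊆ (there x∈) (here refl) _ = inj₂ (refl ∷ from∈ x∈)
∈-∈⇒pair⊆ {ys = z ∷ _} (there x∈) (there y∈) x≢y with ∈-∈⇒pair⊆ x∈ y∈ x≢y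
... | inj₁ p = inj₁ (z ∷ʳ p)
... | inj₂ p = inj₂ (z ∷ʳ p)

SplitStep : (ℕ → ℕ → Set) → (List ℕ → Set) → Set
SplitStep _≺_ P = ∀ γ m δ → All (m ≺_) γ → All (m ≺_) δ → Unique (γ ++ m ∷ δ) → P γ → P δ → P (γ ++ m ∷ δ)

module ExtremalInduction
  (_≼_ _≺_ : ℕ → ℕ → Set) (≼∧≢⇒≺ : ∀ {m y} → m ≼ y → m ≢ y → m ≺ y)
  (extremum : ∀ x xs → ∃ λ m → m ∈ x ∷ xs × All (m ≼_) (x ∷ xs))
  (P : List ℕ → Set) (P[] : P []) (P-split : SplitStep _≺_ P)
  where

  private
    _⊏_ : List ℕ → List ℕ → Set
    xs ⊏ ys = length xs < length ys

    strict : ∀ {m ys} → All (m ≼_) ys → m ∉ ys → All (m ≺_) ys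
    strict m≼ys m∉ys = All.tabulate λ y∈ys → ≼∧≢⇒≺ (All.lookup m≼ys y∈ys) λ { refl → m∉ys y∈ys }

    prefix-⊏ : ∀ γ {m δ} → γ ⊏ (γ ++ m ∷ δ)
    prefix-⊏ γ {m} {δ} rewrite length-++ γ {m ∷ δ} = m<m+n (length γ) z<s

    suffix-⊏ : ∀ γ {m δ} → δ ⊏ (γ ++ m ∷ δ)
    suffix-⊏ γ {m} {δ} rewrite length-++ γ {m ∷ δ} = m≤n+m (suc (length δ)) (length γ)

    go : ∀ xs → Acc _⊏_ xs → Unique xs → P xs
    goAt : ∀ {xs} → (∃ λ m → m ∈ xs × All (m ≼_) xs) → Acc _⊏_ xs → Unique xs → P xs
    go [] _ _ = P[]
    go (x ∷ xs) = goAt (extremum x xs)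
    goAt (m , m∈ , m≼) (acc rec) u with ∈-∃++ m∈
    ... | γ , δ , refl with AllPairs-resp-⊇ (ys⊆xs++ys γ) u
    ...   | m≢δ ∷ uδ = P-split γ m δ
      (strict (All.++⁻ˡ γ m≼) λ m∈γ → Unique-++⇒disjoint γ u m∈γ (here refl))
      (strict (All.tail (All.++⁻ʳ γ m≼)) λ m∈δ → All.lookup m≢δ m∈δ refl)
      u
      (go γ (rec (prefix-⊏ γ)) (AllPairs-resp-⊇ (xs⊆xs++ys γ) u))
      (go δ (rec (suffix-⊏ γ)) uδ)

  induction : ∀ xs → Unique xs → P xs
  induction xs = go xs (On.wellFounded length <-wellFounded xs)

least : ∀ x xs → ∃ λ m → m ∈ x ∷ xs × All (m ≤_) (x ∷ xs)
least x xs = min x xs , [ here , there ]′ (argmin-sel id x xs) , min≤⊤ x xs ∷ min≤xs x xs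

greatest : ∀ x xs → ∃ λ m → m ∈ x ∷ xs × All (m ≥_) (x ∷ xs)
greatest x xs = max x xs , [ here , there ]′ (argmax-sel id x xs) , ⊥≤max x xs ∷ xs≤max x xs

module ByMinimum = ExtremalInduction _≤_ _<_ ≤∧≢⇒< least
module ByMaximum = ExtremalInduction _≥_ _>_ (λ n≤m m≢n → ≤∧≢⇒< n≤m (m≢n ∘ sym)) greatest

-- Patterns

-- Occurrences of patterns are sublists: a ∷ b ∷ [] ⊆ ys says that a occurs before b in ys.
EveryPair : (ℕ → ℕ → Set) → List ℕ → Set
EveryPair R ys = ∀ {a b} → a ∷ b ∷ [] ⊆ ys → R a b

Increasing Decreasing : List ℕ → Set
Increasing = EveryPair _<_
Decreasing = EveryPair _≥_

module _ {R : ℕ → ℕ → Set} where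

  EveryPair-resp-⊇ : ∀ {xs ys} → ys ⊆ xs → EveryPair R xs → EveryPair R ys
  EveryPair-resp-⊇ ys⊆xs r p = r (⊆-trans p ys⊆xs)

  EveryPair-[_] : ∀ x → EveryPair R [ x ]
  EveryPair-[ x ] (_ ∷ʳ ())
  EveryPair-[ x ] (_ ∷ ())

  EveryPair-∷ : ∀ {x xs} → All (R x) xs → EveryPair R xs → EveryPair R (x ∷ xs)
  EveryPair-∷ rx r (_ ∷ʳ p) = r p
  EveryPair-∷ rx r (refl ∷ p) = All.lookup rx (to∈ p)

  EveryPair-++ : ∀ {xs ys} → EveryPair R xs → EveryPair R ys →
    (∀ {x y} → x ∈ xs → y ∈ ys → R x y) → EveryPair R (xs ++ ys)
  EveryPair-++ {xs} {ys} rx ry rxy p with ⊆-++⁻ xs ys p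
  ... | [] , _ , refl , _ , q = ry q
  ... | _ ∷ [] , _ ∷ [] , refl , p , q = rxy (to∈ p) (to∈ q)
  ... | _ ∷ _ ∷ [] , [] , refl , p , _ = rx p

  AllPairs⇒EveryPair : ∀ {xs} → AllPairs R xs → EveryPair R xs
  AllPairs⇒EveryPair rs p with AllPairs-resp-⊇ p rs
  ... | (r ∷ []) ∷ _ = r

  EveryPair⇒AllPairs : ∀ xs → EveryPair R xs → AllPairs R xs
  EveryPair⇒AllPairs [] _ = []
  EveryPair⇒AllPairs (x ∷ xs) r =
    All.tabulate (λ y∈ → r (refl ∷ from∈ y∈)) ∷ EveryPair⇒AllPairs xs (λ p → r (x ∷ʳ p))

Increasing-↭⇒≡ : ∀ {xs ys} → Increasing xs → Increasing ys → xs ↭ ys → xs ≡ ys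
Increasing-↭⇒≡ {xs} {ys} inc₁ inc₂ p = ≋⇒≡ (↗↭↗⇒≋ ≤-totalOrder (sorted xs inc₁) (sorted ys inc₂) (↭⇒↭ₛ p))
  where
  sorted : ∀ zs → Increasing zs → Sorted ≤-totalOrder zs
  sorted zs inc = AllPairs⇒Linked (AllPairs.map <⇒≤ (EveryPair⇒AllPairs zs inc))

Avoids231 Avoids132 Avoids3214-4213 : List ℕ → Set
Avoids231 ys = ∀ {a b c} → a ∷ b ∷ c ∷ [] ⊆ ys → c < a → a < b → ⊥
Avoids132 ys = ∀ {a c b} → a ∷ c ∷ b ∷ [] ⊆ ys → a < b → b < c → ⊥
-- c < b < a and b < d: the pattern 3214 if a < d, and 4213 if d < a.
Avoids3214-4213 ys = ∀ {a b c d} → a ∷ b ∷ c ∷ d ∷ [] ⊆ ys → b < a → c < b → b < d → ⊥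

Avoids132-3214-4213 : List ℕ → Set
Avoids132-3214-4213 ys = Avoids132 ys × Avoids3214-4213 ys

Avoids231-resp-⊇ : ∀ {xs ys} → ys ⊆ xs → Avoids231 xs → Avoids231 ys
Avoids231-resp-⊇ ys⊆xs av p = av (⊆-trans p ys⊆xs)

Avoids132-3214-4213-resp-⊇ : ∀ {xs ys} → ys ⊆ xs → Avoids132-3214-4213 xs → Avoids132-3214-4213 ys
Avoids132-3214-4213-resp-⊇ ys⊆xs (av₁ , av₂) = (λ p → av₁ (⊆-trans p ys⊆xs)) , (λ p → av₂ (⊆-trans p ys⊆xs))

Increasing⇒Avoids132-3214-4213 : ∀ {ys} → Increasing ys → Avoids132-3214-4213 ys
Increasing⇒Avoids132-3214-4213 inc =
  (λ p _ b<c → <-asym b<c (inc (Sublist.∷ˡ⁻ p))) ,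
  (λ p b<a _ _ → <-asym b<a (inc (⊆-prefix (_ ∷ _ ∷ []) p)))

No231Across : List ℕ → List ℕ → Set
No231Across P D = ∀ {p y z} → p ∈ P → y ∷ z ∷ [] ⊆ D → z < p → p < y → ⊥

Avoids231⇒No231Across : ∀ P {D} → Avoids231 (P ++ D) → No231Across P D
Avoids231⇒No231Across P av p∈ q = av (Sublist.++⁺ (from∈ p∈) q)

Avoids231⇒Decreasing : ∀ P {m D} → Avoids231 (P ++ m ∷ D) → All (m <_) P → Decreasing P
Avoids231⇒Decreasing P {D = D} av m<P p =
  ≮⇒≥ λ a<b → av (Sublist.++⁺ p (refl ∷ minimum D)) (All.lookup m<P (to∈ p)) a<b

Avoids231-++ : ∀ {P D} → Decreasing P → Decreasing D → No231Across P D → Avoids231 (P ++ D)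
Avoids231-++ {P} {D} decP decD across p c<a a<b with ⊆-++⁻ P D p
... | [] , _ , refl , _ , q = ≤⇒≯ (decD (⊆-prefix (_ ∷ _ ∷ []) q)) a<b
... | _ ∷ [] , _ , refl , p′ , q = across (to∈ p′) q c<a a<b
... | _ ∷ _ ∷ [] , _ , refl , p′ , _ = ≤⇒≯ (decP p′) a<b
... | _ ∷ _ ∷ _ ∷ [] , _ , refl , p′ , _ = ≤⇒≯ (decP (⊆-prefix (_ ∷ _ ∷ []) p′)) a<b

Avoids231-++-min : ∀ {P m D} → Decreasing P → Decreasing D → No231Across P D →
  All (m <_) P → All (m <_) D → Avoids231 (P ++ m ∷ D)
Avoids231-++-min {P} {m} {D} decP decD across m<P m<D =
  subst Avoids231 (++-assoc P [ m ] D) (Avoids231-++ decPm decD acrossPm)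
  where
  decPm : Decreasing (P ++ [ m ])
  decPm = EveryPair-++ decP (EveryPair-[_] {_≥_} m) λ p∈ → λ { (here refl) → <⇒≤ (All.lookup m<P p∈) }
  acrossPm : No231Across (P ++ [ m ]) D
  acrossPm p∈ q z<p p<y with ∈-++⁻ P p∈
  ... | inj₁ p∈P = across p∈P q z<p p<y
  ... | inj₂ (here refl) = <-asym z<p (All.lookup m<D (to∈ (Sublist.∷ˡ⁻ q)))

Avoids132-++ : ∀ {Γ Δ} → Avoids132 Γ → Increasing Δ →
  (∀ {a c b} → a ∷ c ∷ [] ⊆ Γ → b ∈ Δ → a < b → b < c → ⊥) → Avoids132 (Γ ++ Δ)
Avoids132-++ {Γ} {Δ} avΓ incΔ across p a<b b<c with ⊆-++⁻ Γ Δ p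
... | _ ∷ _ ∷ _ ∷ [] , [] , refl , p′ , _ = avΓ p′ a<b b<c
... | _ ∷ _ ∷ [] , _ ∷ [] , refl , p′ , q = across p′ (to∈ q) a<b b<c
... | _ ∷ [] , _ ∷ _ ∷ [] , refl , _ , q = <-asym b<c (incΔ q)
... | [] , _ ∷ _ ∷ _ ∷ [] , refl , _ , q = <-asym b<c (incΔ (Sublist.∷ˡ⁻ q))

Avoids3214-4213-++ : ∀ {Γ Δ} → Avoids3214-4213 Γ → Increasing Δ →
  (∀ {a b d} → a ∷ b ∷ [] ⊆ Γ → b < a → d ∈ Δ → b < d → ⊥) → Avoids3214-4213 (Γ ++ Δ)
Avoids3214-4213-++ {Γ} {Δ} avΓ incΔ across p b<a c<b b<d with ⊆-++⁻ Γ Δ p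
... | _ ∷ _ ∷ _ ∷ _ ∷ [] , [] , refl , p′ , _ = avΓ p′ b<a c<b b<d
... | _ ∷ _ ∷ _ ∷ [] , _ ∷ [] , refl , p′ , q = across (⊆-prefix (_ ∷ _ ∷ []) p′) b<a (to∈ q) b<d
... | _ ∷ _ ∷ [] , _ ∷ _ ∷ [] , refl , p′ , q = across p′ b<a (to∈ (Sublist.∷ˡ⁻ q)) b<d
... | _ ∷ [] , _ ∷ _ ∷ _ ∷ [] , refl , _ , q = <-asym c<b (incΔ (⊆-prefix (_ ∷ _ ∷ []) q))
... | [] , _ ∷ _ ∷ _ ∷ _ ∷ [] , refl , _ , q = <-asym c<b (incΔ (⊆-prefix (_ ∷ _ ∷ []) (Sublist.∷ˡ⁻ q)))

Avoids132⇒Increasing-after-min : ∀ γ m δ → All (m <_) δ → Unique δ → Avoids132 (γ ++ m ∷ δ) → Increasing δ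
Avoids132⇒Increasing-after-min γ m δ m<δ uδ av p =
  ≤∧≢⇒< (≮⇒≥ λ y<x → av (Sublist.++⁺ˡ γ (refl ∷ p)) (All.lookup m<δ (to∈ (Sublist.∷ˡ⁻ p))) y<x)
        (Unique⇒≢ uδ p)

-- Stack machines

StackStep : Set
StackStep = ℕ → List ℕ → List ℕ × List ℕ

output finalStack : StackStep → List ℕ → List ℕ → List ℕ
output f st [] = []
output f st (x ∷ xs) = proj₁ (f x st) ++ output f (proj₂ (f x st)) xs
finalStack f st [] = st
finalStack f st (x ∷ xs) = finalStack f (proj₂ (f x st)) xs

module _ (f : StackStep) where

  finalStack-++ : ∀ st xs {ys} → finalStack f st (xs ++ ys) ≡ finalStack f (finalStack f st xs) ys
  finalStack-++ st [] = refl
  finalStack-++ st (x ∷ xs) = finalStack-++ (proj₂ (f x st)) xs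

  output-++ : ∀ st xs {ys} → output f st (xs ++ ys) ≡ output f st xs ++ output f (finalStack f st xs) ys
  output-++ st [] = refl
  output-++ st (x ∷ xs) =
    trans (cong (proj₁ (f x st) ++_) (output-++ (proj₂ (f x st)) xs)) (sym (++-assoc (proj₁ (f x st)) _ _))

PopsThenPushes : StackStep → Set
PopsThenPushes f = ∀ t st → ∃₂ λ popped rest → f t st ≡ (popped , t ∷ rest) × popped ++ rest ≡ st

module _ {f : StackStep} (f-pops : PopsThenPushes f) where

  All-step : ∀ {P : ℕ → Set} {t st} → All P (t ∷ st) → All P (proj₂ (f t st))
  All-step {t = t} {st} (pt ∷ pst) with f-pops t st
  ... | popped , _ , eq , refl rewrite eq = pt ∷ All.++⁻ʳ popped pst

  All-finalStack : ∀ {P : ℕ → Set} {st} xs → All P st → All P xs → All P (finalStack f st xs)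
  All-finalStack [] pst _ = pst
  All-finalStack (x ∷ xs) pst (px ∷ pxs) = All-finalStack xs (All-step (px ∷ pst)) pxs

  finalStack-nonempty : ∀ st x xs → ∃₂ λ y ys → finalStack f st (x ∷ xs) ≡ y ∷ ys
  finalStack-nonempty st x [] with f-pops x st
  ... | _ , rest , eq , _ rewrite eq = x , rest , refl
  finalStack-nonempty st x (x′ ∷ xs) = finalStack-nonempty _ x′ xs

  output++finalStack-↭ : ∀ st xs → output f st xs ++ finalStack f st xs ↭ st ++ xs
  output++finalStack-↭ st [] = ↭-reflexive (sym (++-identityʳ st))
  output++finalStack-↭ st (x ∷ xs) with f-pops x st
  ... | o , r , eq , refl rewrite eq = begin
    (o ++ output f (x ∷ r) xs) ++ finalStack f (x ∷ r) xs  ≡⟨ ++-assoc o _ _ ⟩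
    o ++ (output f (x ∷ r) xs ++ finalStack f (x ∷ r) xs)  ↭⟨ ++⁺ˡ o (output++finalStack-↭ (x ∷ r) xs) ⟩
    o ++ x ∷ r ++ xs                                        ↭⟨ ++⁺ˡ o (shift x r xs) ⟨
    o ++ r ++ x ∷ xs                                        ≡⟨ ++-assoc o r _ ⟨
    (o ++ r) ++ x ∷ xs                                      ∎
    where open PermutationReasoning

runS123-output : ∀ st xs → runS123 st xs ≡ output popStep st xs ++ finalStack popStep st xs
runS123-output st [] = refl
runS123-output st (x ∷ xs) with popStep x st
... | o , st′ = trans (cong (o ++_) (runS123-output st′ xs)) (sym (++-assoc o _ _))

runWest-output : ∀ st xs → runWest st xs ≡ output westStep st xs ++ finalStack westStep st xs
runWest-output st [] = refl
runWest-output st (x ∷ xs) with westStep x st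
... | o , st′ = trans (cong (o ++_) (runWest-output st′ xs)) (sym (++-assoc o _ _))

<ᵇ≡true : ∀ {m n} → m < n → (m <ᵇ n) ≡ true
<ᵇ≡true m<n = Equivalence.to T-≡ (<⇒<ᵇ m<n)

<ᵇ≡false : ∀ {m n} → n ≤ m → (m <ᵇ n) ≡ false
<ᵇ≡false {m} {n} n≤m with m <ᵇ n in eq
... | false = refl
... | true = contradiction (<ᵇ⇒< m n (Equivalence.from T-≡ eq)) (≤⇒≯ n≤m)

<ᵇ≡false⇒≥ : ∀ {m n} → (m <ᵇ n) ≡ false → n ≤ m
<ᵇ≡false⇒≥ eq = ≮⇒≥ λ m<n → subst T eq (<⇒<ᵇ m<n)

contraposeᵇ : ∀ {a b} → (a ≡ true → b ≡ true) → b ≡ false → a ≡ false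
contraposeᵇ {false} _ _ = refl
contraposeᵇ {true} a⇒b b≡false with () ← trans (sym (a⇒b refl)) b≡false

hasAscent : List ℕ → Bool
hasAscent (x ∷ y ∷ ys) = (x <ᵇ y) ∨ hasAscent (y ∷ ys)
hasAscent _ = false

hasAscent-∷ : ∀ x ys → hasAscent ys ≡ true → hasAscent (x ∷ ys) ≡ true
hasAscent-∷ x (y ∷ _ ∷ _) eq rewrite eq = ∨-zeroʳ (x <ᵇ y)

hasAscent-∷⁻ : ∀ x ys → hasAscent (x ∷ ys) ≡ false → hasAscent ys ≡ false
hasAscent-∷⁻ x [] _ = refl
hasAscent-∷⁻ x (y ∷ ys) = ∨-conicalʳ (x <ᵇ y) _

hasAscent-++ : ∀ xs {ys} → hasAscent ys ≡ true → hasAscent (xs ++ ys) ≡ true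
hasAscent-++ [] eq = eq
hasAscent-++ (x ∷ xs) eq = hasAscent-∷ x (xs ++ _) (hasAscent-++ xs eq)

hasAscent-∷ʳ-min : ∀ m s → All (m <_) s → hasAscent (s ++ [ m ]) ≡ hasAscent s
hasAscent-∷ʳ-min m [] _ = refl
hasAscent-∷ʳ-min m (h ∷ []) (m<h ∷ _) rewrite <ᵇ≡false {h} {m} (<⇒≤ m<h) = refl
hasAscent-∷ʳ-min m (h ∷ h′ ∷ r) (_ ∷ m<h′r) rewrite hasAscent-∷ʳ-min m (h′ ∷ r) m<h′r = refl

noAscent⇒Decreasing : ∀ ys → hasAscent ys ≡ false → Decreasing ys
noAscent⇒Decreasing (x ∷ xs) noAsc (_ ∷ʳ p) = noAscent⇒Decreasing xs (hasAscent-∷⁻ x xs noAsc) p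
noAscent⇒Decreasing (x ∷ xs) noAsc (refl ∷ p) = head-≥ x xs noAsc (to∈ p)
  where
  head-≥ : ∀ x xs {b} → hasAscent (x ∷ xs) ≡ false → b ∈ xs → x ≥ b
  head-≥ x (y ∷ ys) noAsc (here refl) = <ᵇ≡false⇒≥ (∨-conicalˡ (x <ᵇ y) _ noAsc)
  head-≥ x (y ∷ ys) noAsc (there b∈) =
    ≤-trans (head-≥ y ys (hasAscent-∷⁻ x (y ∷ ys) noAsc) b∈) (<ᵇ≡false⇒≥ (∨-conicalˡ (x <ᵇ y) _ noAsc))

adjAbove⇒hasAscent : ∀ x ys → adjAbove x ys ≡ true → hasAscent ys ≡ true
adjAbove⇒hasAscent x (y ∷ z ∷ r) = step (x <ᵇ y) (y <ᵇ z) (adjAbove⇒hasAscent x (z ∷ r))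
  where
  step : ∀ c b {a h} → (a ≡ true → h ≡ true) → (c ∧ b) ∨ a ≡ true → b ∨ h ≡ true
  step _     true  _   _ = refl
  step true  false a⇒h = a⇒h
  step false false a⇒h = a⇒h

contains1-23⇒hasAscent : ∀ ys → contains1-23 ys ≡ true → hasAscent ys ≡ true
contains1-23⇒hasAscent (x ∷ xs) eq with adjAbove x xs in adj
... | true  = hasAscent-∷ x xs (adjAbove⇒hasAscent x xs adj)
... | false = hasAscent-∷ x xs (contains1-23⇒hasAscent xs eq)

adjAbove-min : ∀ m ys → All (m <_) ys → adjAbove m ys ≡ hasAscent ys
adjAbove-min m [] _ = refl
adjAbove-min m (y ∷ []) _ = refl
adjAbove-min m (y ∷ z ∷ r) (m<y ∷ m<zr) rewrite <ᵇ≡true m<y | adjAbove-min m (z ∷ r) m<zr = refl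

contains1-23-min : ∀ m ys → All (m <_) ys → contains1-23 (m ∷ ys) ≡ hasAscent ys
contains1-23-min m ys m<ys rewrite adjAbove-min m ys m<ys with hasAscent ys in asc
... | true  = refl
... | false = contraposeᵇ (contains1-23⇒hasAscent ys) asc

-- Entries above m exceed it, so no adjacent pair involving m or the ascent-free D completes a 1-23.
adjAbove-floor : ∀ m x ys D → m < x → All (m <_) ys → hasAscent D ≡ false →
  adjAbove x (ys ++ m ∷ D) ≡ adjAbove x ys
adjAbove-floor m x [] [] _ _ _ = refl
adjAbove-floor m x [] (z ∷ r) m<x _ noAsc rewrite <ᵇ≡false {x} {m} (<⇒≤ m<x) =
  contraposeᵇ (adjAbove⇒hasAscent x (z ∷ r)) noAsc
adjAbove-floor m x (y ∷ []) D m<x (m<y ∷ []) noAsc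
  rewrite <ᵇ≡false {y} {m} (<⇒≤ m<y) | ∧-zeroʳ (x <ᵇ y) = adjAbove-floor m x [] D m<x [] noAsc
adjAbove-floor m x (y ∷ z ∷ r) D m<x (_ ∷ m<zr) noAsc
  rewrite adjAbove-floor m x (z ∷ r) D m<x m<zr noAsc = refl

contains1-23-floor : ∀ m xs D → All (m <_) xs → hasAscent D ≡ false →
  contains1-23 (xs ++ m ∷ D) ≡ contains1-23 xs
contains1-23-floor m [] D _ noAsc rewrite contraposeᵇ (adjAbove⇒hasAscent m D) noAsc =
  contraposeᵇ (contains1-23⇒hasAscent D) noAsc
contains1-23-floor m (x ∷ xs) D (m<x ∷ m<xs) noAsc
  rewrite adjAbove-floor m x xs D m<x m<xs noAsc | contains1-23-floor m xs D m<xs noAsc = refl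

-- The map 𝔰_{1\underline{23}} around the least entry

popStep-unfold : ∀ t h st → popStep t (h ∷ st) ≡
  (if contains1-23 (t ∷ h ∷ st) then (h ∷ proj₁ (popStep t st) , proj₂ (popStep t st))
   else ([] , t ∷ h ∷ st))
popStep-unfold t h st with contains1-23 (t ∷ h ∷ st)
... | true with popStep t st
...   | o , st′ = refl
popStep-unfold t h st | false = refl

popStep-pops : PopsThenPushes popStep
popStep-pops t [] = [] , [] , refl , refl
popStep-pops t (h ∷ st) rewrite popStep-unfold t h st with contains1-23 (t ∷ h ∷ st)
... | false = [] , h ∷ st , refl , refl
... | true with popStep-pops t st
...   | o , r , eq , refl rewrite eq = h ∷ o , r , refl , refl

module _ (m : ℕ) (D : List ℕ) (noAsc : hasAscent D ≡ false) where

  popStep-floor : ∀ t s → All (m <_) (t ∷ s) →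
    popStep t (s ++ m ∷ D) ≡ (proj₁ (popStep t s) , proj₂ (popStep t s) ++ m ∷ D)
  popStep-floor t [] m<t rewrite popStep-unfold t m D | contains1-23-floor m (t ∷ []) D m<t noAsc = refl
  popStep-floor t (h ∷ s) m<ths@(m<t ∷ _ ∷ m<s)
    rewrite popStep-unfold t h (s ++ m ∷ D) | popStep-unfold t h s
          | contains1-23-floor m (t ∷ h ∷ s) D m<ths noAsc with contains1-23 (t ∷ h ∷ s)
  ... | true rewrite popStep-floor t s (m<t ∷ m<s) = refl
  ... | false = refl

  output-popStep-floor : ∀ s δ → All (m <_) s → All (m <_) δ →
    output popStep (s ++ m ∷ D) δ ≡ output popStep s δ
  output-popStep-floor s [] _ _ = refl
  output-popStep-floor s (x ∷ δ) m<s (m<x ∷ m<δ) rewrite popStep-floor x s (m<x ∷ m<s) =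
    cong (proj₁ (popStep x s) ++_) (output-popStep-floor _ δ (All-step popStep-pops (m<x ∷ m<s)) m<δ)

  finalStack-popStep-floor : ∀ s δ → All (m <_) s → All (m <_) δ →
    finalStack popStep (s ++ m ∷ D) δ ≡ finalStack popStep s δ ++ m ∷ D
  finalStack-popStep-floor s [] _ _ = refl
  finalStack-popStep-floor s (x ∷ δ) m<s (m<x ∷ m<δ) rewrite popStep-floor x s (m<x ∷ m<s) =
    finalStack-popStep-floor _ δ (All-step popStep-pops (m<x ∷ m<s)) m<δ

-- An incoming entry below the whole stack pops exactly while the stack has an adjacent ascent
-- (popStep-min), i.e. down to the longest ascent-free suffix of the stack.
minSplit : List ℕ → List ℕ × List ℕ
minSplit [] = [] , []
minSplit (h ∷ t) =
  if hasAscent (h ∷ t) then (h ∷ proj₁ (minSplit t) , proj₂ (minSplit t)) else ([] , h ∷ t)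

minSplit-++ : ∀ s → proj₁ (minSplit s) ++ proj₂ (minSplit s) ≡ s
minSplit-++ [] = refl
minSplit-++ (h ∷ t) with hasAscent (h ∷ t)
... | true  = cong (h ∷_) (minSplit-++ t)
... | false = refl

minSplit-noAscent : ∀ s → hasAscent (proj₂ (minSplit s)) ≡ false
minSplit-noAscent [] = refl
minSplit-noAscent (h ∷ t) with hasAscent (h ∷ t) in asc
... | true  = minSplit-noAscent t
... | false = asc

minSplit-nonempty : ∀ h t → ∃₂ λ d D → proj₂ (minSplit (h ∷ t)) ≡ d ∷ D
minSplit-nonempty h t with hasAscent (h ∷ t) in asc
minSplit-nonempty h []       | true with () ← asc
minSplit-nonempty h (h′ ∷ t) | true  = minSplit-nonempty h′ t
minSplit-nonempty h t        | false = h , t , refl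

popStep-min : ∀ m s → All (m <_) s → popStep m s ≡ (proj₁ (minSplit s) , m ∷ proj₂ (minSplit s))
popStep-min m [] _ = refl
popStep-min m (h ∷ t) m<ht@(_ ∷ m<t)
  rewrite popStep-unfold m h t | contains1-23-min m (h ∷ t) m<ht with hasAscent (h ∷ t)
... | true rewrite popStep-min m t m<t = refl
... | false = refl

minSplit-onto-min : ∀ A m d D → hasAscent (d ∷ D) ≡ false → m < d →
  minSplit (A ++ m ∷ d ∷ D) ≡ (A ++ [ m ] , d ∷ D)
minSplit-onto-min [] m d D noAsc m<d rewrite <ᵇ≡true m<d | noAsc = refl
minSplit-onto-min (a ∷ A) m d D noAsc m<d
  rewrite hasAscent-++ (a ∷ A) {m ∷ d ∷ D} (cong (_∨ hasAscent (d ∷ D)) (<ᵇ≡true m<d))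
        | minSplit-onto-min A m d D noAsc m<d = refl

minSplit-∷ʳ-min : ∀ m s → All (m <_) s →
  minSplit (s ++ [ m ]) ≡ (proj₁ (minSplit s) , proj₂ (minSplit s) ++ [ m ])
minSplit-∷ʳ-min m [] _ = refl
minSplit-∷ʳ-min m (h ∷ t) m<ht@(_ ∷ m<t) rewrite hasAscent-∷ʳ-min m (h ∷ t) m<ht with hasAscent (h ∷ t)
... | true rewrite minSplit-∷ʳ-min m t m<t = refl
... | false = refl

-- Reading xs from the empty stack, 𝔰_{1\underline{23}} emits `emitted xs` and is left with
-- `stack xs`, whose ascent-free bottom `base xs` would survive the arrival of a new least entry.
emitted stack front base : List ℕ → List ℕ
emitted = output popStep []
stack = finalStack popStep []
front xs = emitted xs ++ proj₁ (minSplit (stack xs))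
base xs = proj₂ (minSplit (stack xs))

s123≡front++base : ∀ xs → s123 xs ≡ front xs ++ base xs
s123≡front++base xs = begin
  s123 xs                                               ≡⟨ runS123-output [] xs ⟩
  emitted xs ++ stack xs                                ≡⟨ cong (emitted xs ++_) (minSplit-++ (stack xs)) ⟨
  emitted xs ++ proj₁ (minSplit (stack xs)) ++ base xs  ≡⟨ ++-assoc (emitted xs) _ _ ⟨
  front xs ++ base xs                                   ∎
  where open ≡-Reasoning

s123-↭ : ∀ xs → s123 xs ↭ xs
s123-↭ xs = ↭-trans (↭-reflexive (runS123-output [] xs)) (output++finalStack-↭ popStep-pops [] xs)

All-base : ∀ {P : ℕ → Set} xs → All P xs → All P (base xs)
All-base xs pxs = All.++⁻ʳ (proj₁ (minSplit (stack xs)))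
  (subst (All _) (sym (minSplit-++ (stack xs))) (All-finalStack popStep-pops xs [] pxs))

base-nonempty : ∀ x xs → ∃₂ λ d D → base (x ∷ xs) ≡ d ∷ D
base-nonempty x xs with finalStack-nonempty popStep-pops [] x xs
... | y , ys , eq rewrite eq = minSplit-nonempty y ys

base-inhabited : ∀ x xs → ∃ (_∈ base (x ∷ xs))
base-inhabited x xs with base-nonempty x xs
... | d , _ , eq = d , subst (d ∈_) (sym eq) (here refl)

module _ γ m δ (m<γ : All (m <_) γ) (m<δ : All (m <_) δ) where

  private
    noAsc : hasAscent (base γ) ≡ false
    noAsc = minSplit-noAscent (stack γ)

    popStep-min-stack : popStep m (stack γ) ≡ (proj₁ (minSplit (stack γ)) , m ∷ base γ)
    popStep-min-stack = popStep-min m (stack γ) (All-finalStack popStep-pops γ [] m<γ)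

  stack-split-min : stack (γ ++ m ∷ δ) ≡ stack δ ++ m ∷ base γ
  stack-split-min = begin
    stack (γ ++ m ∷ δ)                       ≡⟨ finalStack-++ popStep [] γ ⟩
    finalStack popStep (stack γ) (m ∷ δ)     ≡⟨ cong (λ p → finalStack popStep (proj₂ p) δ) popStep-min-stack ⟩
    finalStack popStep ([] ++ m ∷ base γ) δ  ≡⟨ finalStack-popStep-floor m (base γ) noAsc [] δ [] m<δ ⟩
    stack δ ++ m ∷ base γ                    ∎
    where open ≡-Reasoning

  emitted-split-min : emitted (γ ++ m ∷ δ) ≡ front γ ++ emitted δ
  emitted-split-min = begin
    emitted (γ ++ m ∷ δ)                                        ≡⟨ output-++ popStep [] γ ⟩
    emitted γ ++ output popStep (stack γ) (m ∷ δ)               ≡⟨ cong (λ p → emitted γ ++ proj₁ p ++ output popStep (proj₂ p) δ)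
                                                                        popStep-min-stack ⟩
    emitted γ ++ popped ++ output popStep ([] ++ m ∷ base γ) δ  ≡⟨ cong (λ o → emitted γ ++ popped ++ o)
                                                                        (output-popStep-floor m (base γ) noAsc [] δ [] m<δ) ⟩
    emitted γ ++ popped ++ emitted δ                            ≡⟨ ++-assoc (emitted γ) _ _ ⟨
    front γ ++ emitted δ                                        ∎
    where
    open ≡-Reasoning
    popped = proj₁ (minSplit (stack γ))

module _ m δ (m<δ : All (m <_) δ) where

  minSplit-stack-min-first : minSplit (stack (m ∷ δ)) ≡ (proj₁ (minSplit (stack δ)) , base δ ++ [ m ])
  minSplit-stack-min-first = trans (cong minSplit (stack-split-min [] m δ [] m<δ))
    (minSplit-∷ʳ-min m (stack δ) (All-finalStack popStep-pops δ [] m<δ))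

  front-min-first : front (m ∷ δ) ≡ front δ
  front-min-first = cong₂ _++_ (emitted-split-min [] m δ [] m<δ) (cong proj₁ minSplit-stack-min-first)

  base-min-first : base (m ∷ δ) ≡ base δ ++ [ m ]
  base-min-first = cong proj₂ minSplit-stack-min-first

  s123-min-first : s123 (m ∷ δ) ≡ s123 δ ++ [ m ]
  s123-min-first = begin
    s123 (m ∷ δ)                   ≡⟨ s123≡front++base (m ∷ δ) ⟩
    front (m ∷ δ) ++ base (m ∷ δ)  ≡⟨ cong₂ _++_ front-min-first base-min-first ⟩
    front δ ++ base δ ++ [ m ]     ≡⟨ ++-assoc (front δ) _ _ ⟨
    (front δ ++ base δ) ++ [ m ]   ≡⟨ cong (_++ [ m ]) (s123≡front++base δ) ⟨
    s123 δ ++ [ m ]                ∎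
    where open ≡-Reasoning

module _ g γ m δ (m<γ : All (m <_) (g ∷ γ)) (m<δ : All (m <_) δ) where

  minSplit-stack-min-inner : minSplit (stack (g ∷ γ ++ m ∷ δ)) ≡ (stack δ ++ [ m ] , base (g ∷ γ))
  minSplit-stack-min-inner with base-nonempty g γ
  ... | d , D , eq = begin
    minSplit (stack (g ∷ γ ++ m ∷ δ))       ≡⟨ cong minSplit (stack-split-min (g ∷ γ) m δ m<γ m<δ) ⟩
    minSplit (stack δ ++ m ∷ base (g ∷ γ))  ≡⟨ cong (λ b → minSplit (stack δ ++ m ∷ b)) eq ⟩
    minSplit (stack δ ++ m ∷ d ∷ D)         ≡⟨ minSplit-onto-min (stack δ) m d D noAsc m<d ⟩
    (stack δ ++ [ m ] , d ∷ D)              ≡⟨ cong (stack δ ++ [ m ] ,_) eq ⟨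
    (stack δ ++ [ m ] , base (g ∷ γ))       ∎
    where
    open ≡-Reasoning
    noAsc : hasAscent (d ∷ D) ≡ false
    noAsc = subst (λ b → hasAscent b ≡ false) eq (minSplit-noAscent (stack (g ∷ γ)))
    m<d : m < d
    m<d = All.head (subst (All (m <_)) eq (All-base (g ∷ γ) m<γ))

  front-min-inner : front (g ∷ γ ++ m ∷ δ) ≡ front (g ∷ γ) ++ s123 δ ++ [ m ]
  front-min-inner = begin
    front (g ∷ γ ++ m ∷ δ)                            ≡⟨ cong₂ _++_ (emitted-split-min (g ∷ γ) m δ m<γ m<δ)
                                                                    (cong proj₁ minSplit-stack-min-inner) ⟩
    (front (g ∷ γ) ++ emitted δ) ++ stack δ ++ [ m ]  ≡⟨ ++-assoc (front (g ∷ γ)) _ _ ⟩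
    front (g ∷ γ) ++ emitted δ ++ stack δ ++ [ m ]    ≡⟨ cong (front (g ∷ γ) ++_) (++-assoc (emitted δ) _ _) ⟨
    front (g ∷ γ) ++ (emitted δ ++ stack δ) ++ [ m ]  ≡⟨ cong (λ s → front (g ∷ γ) ++ s ++ [ m ]) (runS123-output [] δ) ⟨
    front (g ∷ γ) ++ s123 δ ++ [ m ]                  ∎
    where open ≡-Reasoning

  base-min-inner : base (g ∷ γ ++ m ∷ δ) ≡ base (g ∷ γ)
  base-min-inner = cong proj₂ minSplit-stack-min-inner

  s123-min-inner : s123 (g ∷ γ ++ m ∷ δ) ≡ (front (g ∷ γ) ++ s123 δ) ++ m ∷ base (g ∷ γ)
  s123-min-inner = begin
    s123 (g ∷ γ ++ m ∷ δ)                               ≡⟨ s123≡front++base (g ∷ γ ++ m ∷ δ) ⟩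
    front (g ∷ γ ++ m ∷ δ) ++ base (g ∷ γ ++ m ∷ δ)     ≡⟨ cong₂ _++_ front-min-inner base-min-inner ⟩
    (front (g ∷ γ) ++ s123 δ ++ [ m ]) ++ base (g ∷ γ)  ≡⟨ ++-assoc (front (g ∷ γ)) _ _ ⟩
    front (g ∷ γ) ++ (s123 δ ++ [ m ]) ++ base (g ∷ γ)  ≡⟨ cong (front (g ∷ γ) ++_) (++-assoc (s123 δ) _ _) ⟩
    front (g ∷ γ) ++ s123 δ ++ m ∷ base (g ∷ γ)         ≡⟨ ++-assoc (front (g ∷ γ)) _ _ ⟨
    (front (g ∷ γ) ++ s123 δ) ++ m ∷ base (g ∷ γ)       ∎
    where open ≡-Reasoning

∈-s123⁻ : ∀ xs {y} → y ∈ s123 xs → y ∈ xs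
∈-s123⁻ xs = ∈-resp-↭ (s123-↭ xs)

∈-s123⁺ : ∀ xs {y} → y ∈ xs → y ∈ s123 xs
∈-s123⁺ xs = ∈-resp-↭ (↭-sym (s123-↭ xs))

All-s123 : ∀ {P : ℕ → Set} xs → All P xs → All P (s123 xs)
All-s123 xs = All-resp-↭ (↭-sym (s123-↭ xs))

∈-front⁻ : ∀ xs {y} → y ∈ front xs → y ∈ xs
∈-front⁻ xs y∈ = ∈-s123⁻ xs (subst (_ ∈_) (sym (s123≡front++base xs)) (∈-++⁺ˡ y∈))

∈-base⁻ : ∀ xs {y} → y ∈ base xs → y ∈ xs
∈-base⁻ xs y∈ = ∈-s123⁻ xs (subst (_ ∈_) (sym (s123≡front++base xs)) (∈-++⁺ʳ (front xs) y∈))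

∈-front⊎base : ∀ xs {y} → y ∈ xs → y ∈ front xs ⊎ y ∈ base xs
∈-front⊎base xs y∈ = ∈-++⁻ (front xs) (subst (_ ∈_) (s123≡front++base xs) (∈-s123⁺ xs y∈))

All-front : ∀ {P : ℕ → Set} xs → All P xs → All P (front xs)
All-front xs pxs = All.tabulate λ y∈ → All.lookup pxs (∈-front⁻ xs y∈)

front-below-base : ∀ xs → Unique xs → ∀ {x} → x ∈ front xs →
  ∃₂ λ x′ y → x′ ∈ front xs × y ∈ base xs × x′ < y
front-below-base = ByMinimum.induction P (λ ()) step
  where
  P : List ℕ → Set
  P xs = ∀ {x} → x ∈ front xs → ∃₂ λ x′ y → x′ ∈ front xs × y ∈ base xs × x′ < y
  step : SplitStep _<_ P
  step [] m δ _ m<δ _ _ IHδ x∈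
    rewrite front-min-first m δ m<δ | base-min-first m δ m<δ with IHδ x∈
  ... | x′ , y , x′∈ , y∈ , x′<y = x′ , y , x′∈ , ∈-++⁺ˡ y∈ , x′<y
  step (g ∷ γ) m δ m<γ m<δ _ _ _ _
    rewrite front-min-inner g γ m δ m<γ m<δ | base-min-inner g γ m δ m<γ m<δ with base-inhabited g γ
  ... | d , d∈ = m , d , ∈-++⁺ʳ (front (g ∷ γ)) (∈-++⁺ʳ (s123 δ) (here refl)) , d∈ ,
                 All.lookup (All-base (g ∷ γ) m<γ) d∈

base-left-maxima : ∀ xs → Unique xs → ∀ {a b} → b ∈ base xs → a ∷ b ∷ [] ⊆ xs → a < b
base-left-maxima = ByMinimum.induction P (λ ()) step
  where
  P : List ℕ → Set
  P xs = ∀ {a b} → b ∈ base xs → a ∷ b ∷ [] ⊆ xs → a < b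
  step : SplitStep _<_ P
  step [] m δ _ m<δ _ _ IHδ b∈ p rewrite base-min-first m δ m<δ with ∈-++⁻ (base δ) b∈ | p
  ... | inj₁ b∈δ         | _ ∷ʳ p′   = IHδ b∈δ p′
  ... | inj₁ b∈δ         | refl ∷ p′ = All.lookup m<δ (to∈ p′)
  ... | inj₂ (here refl) | _ ∷ʳ p′   = ⊥-elim (<-irrefl refl (All.lookup m<δ (to∈ (Sublist.∷ˡ⁻ p′))))
  ... | inj₂ (here refl) | refl ∷ p′ = ⊥-elim (<-irrefl refl (All.lookup m<δ (to∈ p′)))
  step (g ∷ γ) m δ m<γ m<δ u IHγ _ b∈ p
    rewrite base-min-inner g γ m δ m<γ m<δ with ⊆-++⁻ (g ∷ γ) (m ∷ δ) p
  ... | _ ∷ _ ∷ [] , [] , refl , p′ , _ = IHγ b∈ p′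
  ... | _ ∷ [] , _ ∷ [] , refl , _ , q = ⊥-elim (Unique-++⇒disjoint (g ∷ γ) u (∈-base⁻ (g ∷ γ) b∈) (to∈ q))
  ... | [] , _ ∷ _ ∷ [] , refl , _ , q =
        ⊥-elim (Unique-++⇒disjoint (g ∷ γ) u (∈-base⁻ (g ∷ γ) b∈) (to∈ (Sublist.∷ˡ⁻ q)))

front-above-inversion : ∀ xs → Unique xs → ∀ {x} → x ∈ front xs →
  ∃₂ λ a y → a ∷ y ∷ [] ⊆ xs × y < a × y ≤ x
front-above-inversion = ByMinimum.induction P (λ ()) step
  where
  P : List ℕ → Set
  P xs = ∀ {x} → x ∈ front xs → ∃₂ λ a y → a ∷ y ∷ [] ⊆ xs × y < a × y ≤ x
  step : SplitStep _<_ P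
  step [] m δ _ m<δ _ _ IHδ x∈ rewrite front-min-first m δ m<δ with IHδ x∈
  ... | a , y , p , y<a , y≤x = a , y , m ∷ʳ p , y<a , y≤x
  step (g ∷ γ) m δ m<γ m<δ _ IHγ _ {x} x∈
    rewrite front-min-inner g γ m δ m<γ m<δ with ∈-++⁻ (front (g ∷ γ)) x∈
  ... | inj₁ x∈γ = let a , y , p , y<a , y≤x = IHγ x∈γ in
                   a , y , ⊆-trans p (xs⊆xs++ys (g ∷ γ)) , y<a , y≤x
  ... | inj₂ x∈δm = g , m , refl ∷ Sublist.++⁺ˡ γ (refl ∷ minimum δ) , All.head m<γ , m≤x (∈-++⁻ (s123 δ) x∈δm)
    where
    m≤x : x ∈ s123 δ ⊎ x ∈ [ m ] → m ≤ x
    m≤x (inj₁ x∈δ) = <⇒≤ (All.lookup m<δ (∈-s123⁻ δ x∈δ))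
    m≤x (inj₂ (here refl)) = ≤-refl

base-order-in-input : ∀ xs → Unique xs → ∀ {y z} → y ∈ base xs → z ∈ base xs → z < y → z ∷ y ∷ [] ⊆ xs
base-order-in-input = ByMinimum.induction P (λ ()) step
  where
  P : List ℕ → Set
  P xs = ∀ {y z} → y ∈ base xs → z ∈ base xs → z < y → z ∷ y ∷ [] ⊆ xs
  step : SplitStep _<_ P
  step [] m δ _ m<δ _ _ IHδ y∈ z∈ z<y
    rewrite base-min-first m δ m<δ with ∈-++⁻ (base δ) y∈ | ∈-++⁻ (base δ) z∈
  ... | inj₁ y∈δ         | inj₁ z∈δ         = m ∷ʳ IHδ y∈δ z∈δ z<y
  ... | inj₁ y∈δ         | inj₂ (here refl) = refl ∷ from∈ (∈-base⁻ δ y∈δ)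
  ... | inj₂ (here refl) | inj₁ z∈δ         = ⊥-elim (<-asym z<y (All.lookup m<δ (∈-base⁻ δ z∈δ)))
  ... | inj₂ (here refl) | inj₂ (here refl) = ⊥-elim (<-irrefl refl z<y)
  step (g ∷ γ) m δ m<γ m<δ _ IHγ _ y∈ z∈ z<y rewrite base-min-inner g γ m δ m<γ m<δ =
    ⊆-trans (IHγ y∈ z∈ z<y) (xs⊆xs++ys (g ∷ γ))

Increasing⇒s123-Decreasing : ∀ xs → Unique xs → Increasing xs → Decreasing (s123 xs)
Increasing⇒s123-Decreasing = ByMinimum.induction P (λ _ ()) step
  where
  P : List ℕ → Set
  P xs = Increasing xs → Decreasing (s123 xs)
  step : SplitStep _<_ P
  step [] m δ _ m<δ _ _ IHδ inc rewrite s123-min-first m δ m<δ =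
    EveryPair-++ (IHδ (EveryPair-resp-⊇ (m ∷ʳ ⊆-refl) inc)) (EveryPair-[_] {_≥_} m)
      λ x∈ → λ { (here refl) → <⇒≤ (All.lookup m<δ (∈-s123⁻ δ x∈)) }
  step (g ∷ γ) m δ m<γ _ _ _ _ inc =
    ⊥-elim (<-asym (All.head m<γ) (inc (refl ∷ Sublist.++⁺ˡ γ (refl ∷ minimum δ))))

s123-Decreasing⇒Increasing : ∀ xs → Unique xs → Decreasing (s123 xs) → Increasing xs
s123-Decreasing⇒Increasing = ByMinimum.induction P (λ _ ()) step
  where
  P : List ℕ → Set
  P xs = Decreasing (s123 xs) → Increasing xs
  step : SplitStep _<_ P
  step [] m δ _ m<δ _ _ IHδ dec rewrite s123-min-first m δ m<δ =
    EveryPair-∷ m<δ (IHδ (EveryPair-resp-⊇ (xs⊆xs++ys (s123 δ)) dec))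
  step (g ∷ γ) m δ m<γ m<δ _ _ _ dec rewrite s123-min-inner g γ m δ m<γ m<δ with base-inhabited g γ
  ... | d , d∈ = ⊥-elim (≤⇒≯ (dec (Sublist.++⁺ˡ (front (g ∷ γ) ++ s123 δ) (refl ∷ from∈ d∈)))
                             (All.lookup (All-base (g ∷ γ) m<γ) d∈))

-- Characterisation of Sort(𝔰_{1\underline{23}})

module Avoids231AtInnerMin g γ m δ (m<γ : All (m <_) (g ∷ γ)) (m<δ : All (m <_) δ)
  (u : Unique (g ∷ γ ++ m ∷ δ)) (av₀ : Avoids231 (s123 (g ∷ γ ++ m ∷ δ))) where

  private
    Γ = g ∷ γ
    P′ = front Γ ++ s123 δ

    av : Avoids231 (P′ ++ m ∷ base Γ)
    av = subst Avoids231 (s123-min-inner g γ m δ m<γ m<δ) av₀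
    uΓ : Unique Γ
    uΓ = AllPairs-resp-⊇ (xs⊆xs++ys Γ) u
    decP : Decreasing P′
    decP = Avoids231⇒Decreasing P′ av (All.++⁺ (All-front Γ m<γ) (All-s123 δ m<δ))
    decB : Decreasing (base Γ)
    decB = noAscent⇒Decreasing (base Γ) (minSplit-noAscent (stack Γ))
    across : No231Across P′ (base Γ)
    across = Avoids231⇒No231Across P′ {base Γ} (Avoids231-resp-⊇ (Sublist.++⁺ ⊆-refl (m ∷ʳ ⊆-refl)) av)
    front≥δ : ∀ {x d} → x ∈ front Γ → d ∈ δ → x ≥ d
    front≥δ x∈ d∈ = decP (Sublist.++⁺ (from∈ x∈) (from∈ (∈-s123⁺ δ d∈)))
    -- If y > b, then y, a form a 231 with b ∈ P′, or a, y contradict Decreasing (base Γ).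
    base<δ : ∀ {a b y} → a ∈ base Γ → b ∈ δ → a < b → y ∈ base Γ → y < b
    base<δ {a} {b} {y} a∈ b∈ a<b y∈ with <-cmp y b
    ... | tri< y<b _ _ = y<b
    ... | tri≈ _ refl _ = ⊥-elim (Unique-++⇒disjoint Γ u (∈-base⁻ Γ y∈) (there b∈))
    ... | tri> _ _ b<y with ∈-∈⇒pair⊆ a∈ y∈ (λ { refl → <-asym a<b b<y })
    ...   | inj₁ a∷y = ⊥-elim (≤⇒≯ (decB a∷y) (<-trans a<b b<y))
    ...   | inj₂ y∷a = ⊥-elim (across (∈-++⁺ʳ (front Γ) (∈-s123⁺ δ b∈)) y∷a a<b b<y)

  s123-Avoids231-before-min : Avoids231 (s123 Γ)
  s123-Avoids231-before-min = subst Avoids231 (sym (s123≡front++base Γ))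
    (Avoids231-++ (EveryPair-resp-⊇ (xs⊆xs++ys (front Γ)) decP) decB (across ∘ ∈-++⁺ˡ))

  Increasing-from-min : Increasing (m ∷ δ)
  Increasing-from-min = EveryPair-∷ m<δ
    (s123-Decreasing⇒Increasing δ (AllPairs.tail (AllPairs-resp-⊇ (ys⊆xs++ys Γ) u))
      (EveryPair-resp-⊇ (ys⊆xs++ys (front Γ)) decP))

  no132-across-min : ∀ {a c b} → a ∷ c ∷ [] ⊆ Γ → b ∈ m ∷ δ → a < b → b < c → ⊥
  no132-across-min p (here refl) a<m _ = <-asym a<m (All.lookup m<γ (to∈ p))
  no132-across-min p (there b∈) a<b b<c with ∈-front⊎base Γ (to∈ p) | ∈-front⊎base Γ (to∈ (Sublist.∷ˡ⁻ p))
  ... | inj₁ a∈F | _ = ≤⇒≯ (front≥δ a∈F b∈) a<b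
  ... | inj₂ a∈B | inj₂ c∈B = <-asym b<c (base<δ a∈B b∈ a<b c∈B)
  ... | inj₂ a∈B | inj₁ c∈F =
    let x′ , y , x′∈ , y∈ , x′<y = front-below-base Γ uΓ c∈F in
    ≤⇒≯ (front≥δ x′∈ b∈) (<-trans x′<y (base<δ a∈B b∈ a<b y∈))

  no3214-4213-across-min : ∀ {a b d} → a ∷ b ∷ [] ⊆ Γ → b < a → d ∈ m ∷ δ → b < d → ⊥
  no3214-4213-across-min p _ (here refl) b<m = <-asym b<m (All.lookup m<γ (to∈ (Sublist.∷ˡ⁻ p)))
  no3214-4213-across-min p b<a (there d∈) b<d with ∈-front⊎base Γ (to∈ (Sublist.∷ˡ⁻ p))
  ... | inj₁ b∈F = ≤⇒≯ (front≥δ b∈F d∈) b<d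
  ... | inj₂ b∈B = <-asym b<a (base-left-maxima Γ uΓ b∈B p)

s123-Avoids231⇒Avoids132-3214-4213 : ∀ xs → Unique xs → Avoids231 (s123 xs) → Avoids132-3214-4213 xs
s123-Avoids231⇒Avoids132-3214-4213 = ByMinimum.induction P (λ _ → (λ ()) , (λ ())) step
  where
  P : List ℕ → Set
  P xs = Avoids231 (s123 xs) → Avoids132-3214-4213 xs
  step : SplitStep _<_ P
  step [] m δ _ m<δ u _ _ av rewrite s123-min-first m δ m<δ =
    Increasing⇒Avoids132-3214-4213 (EveryPair-∷ m<δ (s123-Decreasing⇒Increasing δ (AllPairs.tail u)
      (Avoids231⇒Decreasing (s123 δ) {D = []} av (All-s123 δ m<δ))))
  step (g ∷ γ) m δ m<γ m<δ u IHγ _ av =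
    Avoids132-++ (proj₁ avΓ) Increasing-from-min no132-across-min ,
    Avoids3214-4213-++ (proj₂ avΓ) Increasing-from-min no3214-4213-across-min
    where
    open Avoids231AtInnerMin g γ m δ m<γ m<δ u av
    avΓ = IHγ s123-Avoids231-before-min

Avoids132-3214-4213⇒s123-Avoids231 : ∀ xs → Unique xs → Avoids132-3214-4213 xs →
  Avoids231 (s123 xs) × Decreasing (front xs)
Avoids132-3214-4213⇒s123-Avoids231 = ByMinimum.induction P (λ _ → (λ ()) , (λ ())) step
  where
  P : List ℕ → Set
  P xs = Avoids132-3214-4213 xs → Avoids231 (s123 xs) × Decreasing (front xs)
  step : SplitStep _<_ P
  step [] m δ _ m<δ u _ IHδ av rewrite s123-min-first m δ m<δ | front-min-first m δ m<δ =
    Avoids231-++-min {D = []} decδ (λ ()) (λ _ ()) (All-s123 δ m<δ) [] ,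
    proj₂ (IHδ (Avoids132-3214-4213-resp-⊇ (m ∷ʳ ⊆-refl) av))
    where
    uδ = AllPairs.tail u
    decδ = Increasing⇒s123-Decreasing δ uδ (Avoids132⇒Increasing-after-min [] m δ m<δ uδ (proj₁ av))
  step (g ∷ γ) m δ m<γ m<δ u IHγ _ av
    rewrite s123-min-inner g γ m δ m<γ m<δ | front-min-inner g γ m δ m<γ m<δ =
    Avoids231-++-min decP decB acrossP m<P (All-base Γ m<γ) ,
    subst Decreasing (++-assoc (front Γ) (s123 δ) [ m ])
      (EveryPair-++ decP (EveryPair-[_] {_≥_} m) λ x∈ → λ { (here refl) → <⇒≤ (All.lookup m<P x∈) })
    where
    Γ = g ∷ γ
    P′ = front Γ ++ s123 δ
    uΓ : Unique Γ
    uΓ = AllPairs-resp-⊇ (xs⊆xs++ys Γ) u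
    uδ : Unique δ
    uδ = AllPairs.tail (AllPairs-resp-⊇ (ys⊆xs++ys Γ) u)
    IH : Avoids231 (s123 Γ) × Decreasing (front Γ)
    IH = IHγ (Avoids132-3214-4213-resp-⊇ (xs⊆xs++ys Γ) av)
    decδ : Decreasing (s123 δ)
    decδ = Increasing⇒s123-Decreasing δ uδ (Avoids132⇒Increasing-after-min Γ m δ m<δ uδ (proj₁ av))
    decB : Decreasing (base Γ)
    decB = noAscent⇒Decreasing (base Γ) (minSplit-noAscent (stack Γ))
    front≥δ : ∀ {x d} → x ∈ front Γ → d ∈ δ → x ≥ d
    front≥δ x∈ d∈ = ≮⇒≥ λ x<d →
      let a , y , p , y<a , y≤x = front-above-inversion Γ uΓ x∈ in
      proj₂ av (Sublist.++⁺ p (refl ∷ from∈ d∈)) y<a (All.lookup m<γ (to∈ (Sublist.∷ˡ⁻ p))) (≤-<-trans y≤x x<d)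
    decP : Decreasing P′
    decP = EveryPair-++ (proj₂ IH) decδ λ x∈ d∈ → front≥δ x∈ (∈-s123⁻ δ d∈)
    acrossP : No231Across P′ (base Γ)
    acrossP p∈ with ∈-++⁻ (front Γ) p∈
    ... | inj₁ p∈F = Avoids231⇒No231Across (front Γ) (subst Avoids231 (s123≡front++base Γ) (proj₁ IH)) p∈F
    ... | inj₂ p∈δ = λ q z<p p<y → proj₁ av
      (Sublist.++⁺ (base-order-in-input Γ uΓ (to∈ q) (to∈ (Sublist.∷ˡ⁻ q)) (<-trans z<p p<y))
                   (m ∷ʳ from∈ (∈-s123⁻ δ p∈δ)))
      z<p p<y
    m<P : All (m <_) P′
    m<P = All.++⁺ (All-front Γ m<γ) (All-s123 δ m<δ)

-- West's stack-sorting map around the greatest entry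

westStep-unfold : ∀ t h st → westStep t (h ∷ st) ≡
  (if h <ᵇ t then (h ∷ proj₁ (westStep t st) , proj₂ (westStep t st)) else ([] , t ∷ h ∷ st))
westStep-unfold t h st with h <ᵇ t
... | true with westStep t st
...   | o , st′ = refl
westStep-unfold t h st | false = refl

westStep-pops : PopsThenPushes westStep
westStep-pops t [] = [] , [] , refl , refl
westStep-pops t (h ∷ st) rewrite westStep-unfold t h st with h <ᵇ t
... | false = [] , h ∷ st , refl , refl
... | true with westStep-pops t st
...   | o , r , eq , refl rewrite eq = h ∷ o , r , refl , refl

west-↭ : ∀ xs → west xs ↭ xs
west-↭ xs = ↭-trans (↭-reflexive (runWest-output [] xs)) (output++finalStack-↭ westStep-pops [] xs)

∈-west⁻ : ∀ xs {y} → y ∈ west xs → y ∈ xs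
∈-west⁻ xs = ∈-resp-↭ (west-↭ xs)

∈-west⁺ : ∀ xs {y} → y ∈ xs → y ∈ west xs
∈-west⁺ xs = ∈-resp-↭ (↭-sym (west-↭ xs))

westStep-max : ∀ n s → All (_< n) s → westStep n s ≡ (s , [ n ])
westStep-max n [] _ = refl
westStep-max n (h ∷ s) (h<n ∷ s<n) rewrite westStep-unfold n h s | <ᵇ≡true h<n | westStep-max n s s<n = refl

module _ (n : ℕ) where

  westStep-floor : ∀ t s → t < n → westStep t (s ++ [ n ]) ≡ (proj₁ (westStep t s) , proj₂ (westStep t s) ++ [ n ])
  westStep-floor t [] t<n rewrite westStep-unfold t n [] | <ᵇ≡false {n} {t} (<⇒≤ t<n) = refl
  westStep-floor t (h ∷ s) t<n rewrite westStep-unfold t h (s ++ [ n ]) | westStep-unfold t h s with h <ᵇ t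
  ... | true rewrite westStep-floor t s t<n = refl
  ... | false = refl

  output-westStep-floor : ∀ s δ → All (_< n) δ → output westStep (s ++ [ n ]) δ ≡ output westStep s δ
  output-westStep-floor s [] _ = refl
  output-westStep-floor s (x ∷ δ) (x<n ∷ δ<n) rewrite westStep-floor x s x<n =
    cong (proj₁ (westStep x s) ++_) (output-westStep-floor _ δ δ<n)

  finalStack-westStep-floor : ∀ s δ → All (_< n) δ →
    finalStack westStep (s ++ [ n ]) δ ≡ finalStack westStep s δ ++ [ n ]
  finalStack-westStep-floor s [] _ = refl
  finalStack-westStep-floor s (x ∷ δ) (x<n ∷ δ<n) rewrite westStep-floor x s x<n =
    finalStack-westStep-floor _ δ δ<n

module _ L n R (L<n : All (_< n) L) (R<n : All (_< n) R) where

  private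
    oL = output westStep [] L
    sL = finalStack westStep [] L
    oR = output westStep [] R
    sR = finalStack westStep [] R

    westStep-max-stack : westStep n sL ≡ (sL , [ n ])
    westStep-max-stack = westStep-max n sL (All-finalStack westStep-pops L [] L<n)

    output-split-max : output westStep [] (L ++ n ∷ R) ≡ west L ++ oR
    output-split-max = begin
      output westStep [] (L ++ n ∷ R)              ≡⟨ output-++ westStep [] L ⟩
      oL ++ output westStep sL (n ∷ R)             ≡⟨ cong (λ p → oL ++ proj₁ p ++ output westStep (proj₂ p) R)
                                                           westStep-max-stack ⟩
      oL ++ sL ++ output westStep ([] ++ [ n ]) R  ≡⟨ cong (λ o → oL ++ sL ++ o) (output-westStep-floor n [] R R<n) ⟩
      oL ++ sL ++ oR                               ≡⟨ ++-assoc oL sL oR ⟨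
      (oL ++ sL) ++ oR                             ≡⟨ cong (_++ oR) (runWest-output [] L) ⟨
      west L ++ oR                                 ∎
      where open ≡-Reasoning

    finalStack-split-max : finalStack westStep [] (L ++ n ∷ R) ≡ sR ++ [ n ]
    finalStack-split-max = begin
      finalStack westStep [] (L ++ n ∷ R)       ≡⟨ finalStack-++ westStep [] L ⟩
      finalStack westStep sL (n ∷ R)            ≡⟨ cong (λ p → finalStack westStep (proj₂ p) R) westStep-max-stack ⟩
      finalStack westStep ([] ++ [ n ]) R       ≡⟨ finalStack-westStep-floor n [] R R<n ⟩
      sR ++ [ n ]                               ∎
      where open ≡-Reasoning

  west-split-max : west (L ++ n ∷ R) ≡ west L ++ west R ++ [ n ]
  west-split-max = begin
    west (L ++ n ∷ R)                ≡⟨ trans (runWest-output [] (L ++ n ∷ R))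
                                                (cong₂ _++_ output-split-max finalStack-split-max) ⟩
    (west L ++ oR) ++ sR ++ [ n ]    ≡⟨ ++-assoc (west L) oR _ ⟩
    west L ++ oR ++ sR ++ [ n ]      ≡⟨ cong (west L ++_) (++-assoc oR sR [ n ]) ⟨
    west L ++ (oR ++ sR) ++ [ n ]    ≡⟨ cong (λ r → west L ++ r ++ [ n ]) (runWest-output [] R) ⟨
    west L ++ west R ++ [ n ]        ∎
    where open ≡-Reasoning

west-Increasing⇒Avoids231 : ∀ σ → Unique σ → Increasing (west σ) → Avoids231 σ
west-Increasing⇒Avoids231 = ByMaximum.induction P (λ _ ()) step
  where
  P : List ℕ → Set
  P σ = Increasing (west σ) → Avoids231 σ
  step : SplitStep _>_ P
  step L n R L<n R<n _ IHL IHR inc₀ = avoids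
    where
    inc : Increasing (west L ++ west R ++ [ n ])
    inc = subst Increasing (west-split-max L n R L<n R<n) inc₀
    L<R : ∀ {a c} → a ∈ L → c ∈ R → a < c
    L<R a∈ c∈ = inc (Sublist.++⁺ (from∈ (∈-west⁺ L a∈)) (from∈ (∈-++⁺ˡ (∈-west⁺ R c∈))))
    avoids : Avoids231 (L ++ n ∷ R)
    avoids p c<a a<b with ⊆-++⁻ L (n ∷ R) p
    ... | _ ∷ _ ∷ _ ∷ [] , [] , refl , p′ , _ = IHL (EveryPair-resp-⊇ (xs⊆xs++ys (west L)) inc) p′ c<a a<b
    ... | _ ∷ _ ∷ [] , _ ∷ [] , refl , p′ , refl ∷ _ = <-asym c<a (All.lookup L<n (to∈ p′))
    ... | _ ∷ _ ∷ [] , _ ∷ [] , refl , p′ , _ ∷ʳ q = <-asym c<a (L<R (to∈ p′) (to∈ q))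
    ... | _ ∷ [] , _ ∷ _ ∷ [] , refl , p′ , refl ∷ q = <-asym c<a (L<R (to∈ p′) (to∈ q))
    ... | _ ∷ [] , _ ∷ _ ∷ [] , refl , p′ , _ ∷ʳ q = <-asym c<a (L<R (to∈ p′) (to∈ (Sublist.∷ˡ⁻ q)))
    ... | [] , _ ∷ _ ∷ _ ∷ [] , refl , _ , refl ∷ q = <-asym a<b (All.lookup R<n (to∈ q))
    ... | [] , _ ∷ _ ∷ _ ∷ [] , refl , _ , _ ∷ʳ q =
          IHR (EveryPair-resp-⊇ (Sublist.++⁺ˡ (west L) (xs⊆xs++ys (west R))) inc) q c<a a<b

Avoids231⇒west-Increasing : ∀ σ → Unique σ → Avoids231 σ → Increasing (west σ)
Avoids231⇒west-Increasing = ByMaximum.induction P (λ _ ()) step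
  where
  P : List ℕ → Set
  P σ = Avoids231 σ → Increasing (west σ)
  step : SplitStep _>_ P
  step L n R L<n R<n u IHL IHR av = subst Increasing (sym (west-split-max L n R L<n R<n))
    (EveryPair-++ incL (EveryPair-++ incR (EveryPair-[_] {_<_} n) R<[n]) cross)
    where
    incL : Increasing (west L)
    incL = IHL (Avoids231-resp-⊇ (xs⊆xs++ys L) av)
    incR : Increasing (west R)
    incR = IHR (Avoids231-resp-⊇ (Sublist.++⁺ˡ L (n ∷ʳ ⊆-refl)) av)
    R<[n] : ∀ {y z} → y ∈ west R → z ∈ [ n ] → y < z
    R<[n] y∈ (here refl) = All.lookup R<n (∈-west⁻ R y∈)
    L<R : ∀ {x y} → x ∈ L → y ∈ R → x < y
    L<R x∈ y∈ = ≤∧≢⇒< (≮⇒≥ λ y<x → av (Sublist.++⁺ (from∈ x∈) (refl ∷ from∈ y∈)) y<x (All.lookup L<n x∈))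
                      λ { refl → Unique-++⇒disjoint L u x∈ (there y∈) }
    cross : ∀ {x y} → x ∈ west L → y ∈ west R ++ [ n ] → x < y
    cross x∈ y∈ with ∈-++⁻ (west R) y∈
    ... | inj₁ y∈R = L<R (∈-west⁻ L x∈) (∈-west⁻ R y∈R)
    ... | inj₂ (here refl) = All.lookup L<n (∈-west⁻ L x∈)

-- Order isomorphisms

module _ {A B : Set} where

  map-proj₁-zip : ∀ (xs : List A) (ys : List B) → length xs ≡ length ys → map proj₁ (zip xs ys) ≡ xs
  map-proj₁-zip [] [] _ = refl
  map-proj₁-zip (x ∷ xs) (y ∷ ys) eq = cong (x ∷_) (map-proj₁-zip xs ys (cong pred eq))

  map-proj₂-zip : ∀ (xs : List A) (ys : List B) → length xs ≡ length ys → map proj₂ (zip xs ys) ≡ ys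
  map-proj₂-zip [] [] _ = refl
  map-proj₂-zip (x ∷ xs) (y ∷ ys) eq = cong (y ∷_) (map-proj₂-zip xs ys (cong pred eq))

  ∈-zip⁻ : ∀ (xs : List A) (ys : List B) (eq : length xs ≡ length ys) {p} → p ∈ zip xs ys →
    ∃ λ i → p ≡ (lookup xs i , lookup ys (cast eq i))
  ∈-zip⁻ (x ∷ xs) (y ∷ ys) eq (here refl) = fzero , refl
  ∈-zip⁻ (x ∷ xs) (y ∷ ys) eq (there p∈) = let i , p≡ = ∈-zip⁻ xs ys (cong pred eq) p∈ in fsuc i , p≡

-- A sublist of ys is matched, through zip xs ys, with the sublist of xs at the same positions.
module _ {xs ys : List ℕ} (xs≅ys : OrderIso xs ys) where

  private
    len = proj₁ xs≅ys
    Z = zip xs ys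

    zip-reflects-< : ∀ {p q} → p ∈ Z → q ∈ Z → proj₂ p < proj₂ q → proj₁ p < proj₁ q
    zip-reflects-< p∈ q∈ with ∈-zip⁻ xs ys len p∈ | ∈-zip⁻ xs ys len q∈
    ... | i , refl | j , refl = Equivalence.from (proj₂ xs≅ys i j)

    pullback : ∀ {ws} → ws ⊆ ys → ∃ λ us → us ⊆ Z × map proj₂ us ≡ ws
    pullback p = ⊆-map⁻ proj₂ Z (subst (_ ⊆_) (sym (map-proj₂-zip xs ys len)) p)

    pushforward : ∀ {us} → us ⊆ Z → map proj₁ us ⊆ xs
    pushforward q = subst (_ ⊆_) (map-proj₁-zip xs ys len) (Sublist.map⁺ proj₁ q)

  OrderIso-Avoids132-3214-4213 : Avoids132-3214-4213 xs → Avoids132-3214-4213 ys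
  OrderIso-Avoids132-3214-4213 (av₁ , av₂) = av₁′ , av₂′
    where
    av₁′ : Avoids132 ys
    av₁′ p a<b b<c with pullback p
    ... | _ ∷ _ ∷ _ ∷ [] , q , refl = av₁ (pushforward q) (zip-reflects-< a∈ b∈ a<b) (zip-reflects-< b∈ c∈ b<c)
      where
      a∈ = to∈ q
      c∈ = to∈ (Sublist.∷ˡ⁻ q)
      b∈ = to∈ (Sublist.∷ˡ⁻ (Sublist.∷ˡ⁻ q))
    av₂′ : Avoids3214-4213 ys
    av₂′ p b<a c<b b<d with pullback p
    ... | _ ∷ _ ∷ _ ∷ _ ∷ [] , q , refl =
      av₂ (pushforward q) (zip-reflects-< b∈ a∈ b<a) (zip-reflects-< c∈ b∈ c<b) (zip-reflects-< b∈ d∈ b<d)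
      where
      a∈ = to∈ q
      b∈ = to∈ (Sublist.∷ˡ⁻ q)
      c∈ = to∈ (Sublist.∷ˡ⁻ (Sublist.∷ˡ⁻ q))
      d∈ = to∈ (Sublist.∷ˡ⁻ (Sublist.∷ˡ⁻ (Sublist.∷ˡ⁻ q)))

Unique-idPerm : ∀ n → Unique (idPerm n)
Unique-idPerm n = Unique.map⁺ suc-injective (Unique.upTo⁺ n)

Increasing-idPerm : ∀ n → Increasing (idPerm n)
Increasing-idPerm n = AllPairs⇒EveryPair {_<_} (AllPairs.map⁺ (AllPairs.applyUpTo⁺₁ id n (λ i<j _ → s≤s i<j)))

IsPerm⇒Unique : ∀ {n xs} → IsPerm n xs → Unique xs
IsPerm⇒Unique {n} p = Permutationₛ.Unique-resp-↭ (setoid ℕ) (↭⇒↭ₛ (↭-sym p)) (Unique-idPerm n)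

Unique-s123 : ∀ {xs} → Unique xs → Unique (s123 xs)
Unique-s123 {xs} u = Permutationₛ.Unique-resp-↭ (setoid ℕ) (↭⇒↭ₛ (↭-sym (s123-↭ xs))) u

InSortN⇒Avoids132-3214-4213 : ∀ {n π} → InSortN n π → Avoids132-3214-4213 π
InSortN⇒Avoids132-3214-4213 {n} {π} (π-perm , sorted) =
  s123-Avoids231⇒Avoids132-3214-4213 π uπ
    (west-Increasing⇒Avoids231 (s123 π) (Unique-s123 uπ) (subst Increasing (sym sorted) (Increasing-idPerm n)))
  where uπ = IsPerm⇒Unique π-perm

Avoids132-3214-4213⇒InSortN : ∀ {k ρ} → IsPerm k ρ → Avoids132-3214-4213 ρ → InSortN k ρ
Avoids132-3214-4213⇒InSortN {k} {ρ} ρ-perm av = ρ-perm ,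
  Increasing-↭⇒≡
    (Avoids231⇒west-Increasing (s123 ρ) (Unique-s123 uρ) (proj₁ (Avoids132-3214-4213⇒s123-Avoids231 ρ uρ av)))
    (Increasing-idPerm k)
    (↭-trans (west-↭ (s123 ρ)) (↭-trans (s123-↭ ρ) ρ-perm))
  where uρ = IsPerm⇒Unique ρ-perm

mainTheorem8 : (π ρ : List ℕ) (k : ℕ) → 1 ≤ k → IsPerm k ρ →
    InSort π → Contains π ρ → InSort ρ
mainTheorem8 π ρ k 1≤k ρ-perm (n , _ , π∈Sortₙ) (σ , σ⊆π , σ≅ρ) =
  k , 1≤k , Avoids132-3214-4213⇒InSortN ρ-perm
    (OrderIso-Avoids132-3214-4213 σ≅ρ
      (Avoids132-3214-4213-resp-⊇ σ⊆π (InSortN⇒Avoids132-3214-4213 π∈Sortₙ)))
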